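{- Let $I$ be a nonempty set, $f:\mathbb{N}\to\overline{\mathbb{R}}^I$, $\rho\in\mathbb{R}$, and let $\pi,\sigma$ be positive integers such that $f$ is eventually periodic with period $\pi$ and ratio $\rho$, and also with period $\sigma$ and ratio $\rho$. Let $T_\pi$ (resp. $T_\sigma$) be the least nonnegative integer $T$ such that $f_i(n+\pi)=f_i(n)+\pi\rho$ (resp. $f_i(n+\sigma)=f_i(n)+\sigma\rho$) for all $i\in I$ and all $n\ge T$. Then $T_\pi=T_\sigma$.
   Context: $\overline{\mathbb{R}}=\mathbb{R}\cup\{ -\infty\}$ with $-\infty+x=-\infty$. $f$ is eventually periodic with period $\pi\in\mathbb{N}^*$ and ratio $\rho$ if there is $T\in\mathbb{N}$ with $f_i(n+\pi)=f_i(n)+\pi\rho$ for all $i\in I$ and $n\ge T$. -}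

module Defs where

open import Level using (0ℓ)
open import Data.Nat using (ℕ; zero; suc) renaming (_+_ to _+ℕ_; _≤_ to _≤ℕ_)
open import Data.Product using (Σ; _×_)
open import Relation.Binary.PropositionalEquality using (_≡_)
open import Relation.Nullary using (¬_)
open import Algebra.Structures using (IsCommutativeRing)
open import Relation.Binary.Structures using (IsTotalOrder)

-- The real numbers, axiomatised (up to isomorphism) as a complete ordered
-- field, with propositional equality as the field equality.
record CompleteOrderedField : Set₁ where
  infixl 6 _+_
  infixl 7 _*_
  infix 4 _≤_
  field
    Carrier : Set
    _+_ _*_ : Carrier → Carrier → Carrier
    -_      : Carrier → Carrier
    0# 1#   : Carrier
    _≤_     : Carrier → Carrier → Set
    isCommutativeRing : IsCommutativeRing _≡_ _+_ _*_ -_ 0# 1#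
    0≢1     : ¬ (0# ≡ 1#)
    inverse : ∀ x → ¬ (x ≡ 0#) → Σ Carrier (λ y → x * y ≡ 1#)
    isTotalOrder : IsTotalOrder _≡_ _≤_
    +-mono-≤ : ∀ x y z → x ≤ y → x + z ≤ y + z
    *-nonneg : ∀ x y → 0# ≤ x → 0# ≤ y → 0# ≤ x * y
    complete : (P : Carrier → Set) → Σ Carrier P →
               Σ Carrier (λ b → ∀ x → P x → x ≤ b) →
               Σ Carrier (λ s → (∀ x → P x → x ≤ s) ×
                                (∀ b → (∀ x → P x → x ≤ b) → s ≤ b))

module _ (R : CompleteOrderedField) where
  open CompleteOrderedField R

  data ℝ̄ : Set where
    -∞  : ℝ̄
    fin : Carrier → ℝ̄

  _+̄_ : ℝ̄ → Carrier → ℝ̄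
  -∞    +̄ x = -∞
  fin y +̄ x = fin (y + x)

  _·_ : ℕ → Carrier → Carrier
  zero  · x = 0#
  suc n · x = x + (n · x)

  PeriodicFrom : {I : Set} → (ℕ → I → ℝ̄) → ℕ → Carrier → ℕ → Set
  PeriodicFrom {I} f π ρ T =
    ∀ (i : I) (n : ℕ) → T ≤ℕ n → f (n +ℕ π) i ≡ (f n i +̄ (π · ρ))

  EventuallyPeriodic : {I : Set} → (ℕ → I → ℝ̄) → ℕ → Carrier → Set
  EventuallyPeriodic f π ρ = Σ ℕ (λ T → PeriodicFrom f π ρ T)

  IsLeastThreshold : {I : Set} → (ℕ → I → ℝ̄) → ℕ → Carrier → ℕ → Set
  IsLeastThreshold f π ρ T =
    PeriodicFrom f π ρ T × (∀ T′ → PeriodicFrom f π ρ T′ → T ≤ℕ T′)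

-- If f is π-periodic from T and σ-periodic from T′ (same ratio ρ), then for
-- n ≥ T the σ-step at n follows from the σ-step at n + kπ ≥ T′: going back by
-- π adds πρ to both sides of the relation, and adding a real to an extended
-- real is injective.  So T is also a σ-threshold, and T′ likewise a
-- π-threshold; minimality gives both inequalities between the least ones.
module Submission where

open import Level using (0ℓ)
open import Defs
open import Algebra.Bundles using (CommutativeRing; AbelianGroup)
open import Data.Nat using (ℕ; _≤_; zero; suc; _+_; _*_; >-nonZero)
open import Data.Nat.Properties
  using (+-assoc; +-identityʳ; +-commutativeSemigroup; ≤-trans; ≤-antisym;
         m≤m+n; m≤n+m; m≤m*n)
open import Data.Product using (_,_)
open import Relation.Binary.PropositionalEquality
import Algebra.Properties.CommutativeSemigroup as CommutativeSemigroupProperties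

open CommutativeSemigroupProperties +-commutativeSemigroup using ()
  renaming (xy∙z≈xz∙y to m+n+o≡m+o+n)

module _ (R : CompleteOrderedField) where
  private
    module ℝ = CompleteOrderedField R
    open ℝ using (Carrier)

    infixl 6 _+̄′_
    _+̄′_ : ℝ̄ R → Carrier → ℝ̄ R
    _+̄′_ = _+̄_ R

    infixr 7 _·′_
    _·′_ : ℕ → Carrier → Carrier
    _·′_ = _·_ R

    ring : CommutativeRing 0ℓ 0ℓ
    ring = record
      { _+_ = ℝ._+_ ; _*_ = ℝ._*_ ; -_ = ℝ.-_ ; 0# = ℝ.0# ; 1# = ℝ.1#
      ; isCommutativeRing = ℝ.isCommutativeRing }

  open CommutativeSemigroupProperties (CommutativeRing.+-commutativeSemigroup ring)
    using (xy∙z≈xz∙y)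
  open import Algebra.Properties.Group
    (AbelianGroup.group (CommutativeRing.+-abelianGroup ring)) using (∙-cancelʳ)

  fin-injective : ∀ {x y} → fin {R} x ≡ fin y → x ≡ y
  fin-injective refl = refl

  +̄-swap : ∀ x a b → x +̄′ a +̄′ b ≡ x +̄′ b +̄′ a
  +̄-swap -∞      a b = refl
  +̄-swap (fin y) a b = cong fin (xy∙z≈xz∙y y a b)

  +̄-cancelʳ : ∀ c {x y} → x +̄′ c ≡ y +̄′ c → x ≡ y
  +̄-cancelʳ c { -∞ }   { -∞ }   _  = refl
  +̄-cancelʳ c {fin x} {fin y} eq = cong fin (∙-cancelʳ c x y (fin-injective eq))

  module _ {I : Set} (f : ℕ → I → ℝ̄ R) (ρ : Carrier) where

    StepsAt : ℕ → ℕ → Set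
    StepsAt σ n = ∀ i → f (n + σ) i ≡ f n i +̄′ σ ·′ ρ

    stepsAt-pullback : ∀ {π σ T n} → PeriodicFrom R f π ρ T → T ≤ n →
                       StepsAt σ (n + π) → StepsAt σ n
    stepsAt-pullback {π} {σ} {T} {n} periodic T≤n steps i = +̄-cancelʳ (π ·′ ρ) (begin
      f (n + σ) i +̄′ π ·′ ρ        ≡⟨ periodic i (n + σ) (≤-trans T≤n (m≤m+n n σ)) ⟨
      f (n + σ + π) i              ≡⟨ cong (λ m → f m i) (m+n+o≡m+o+n n σ π) ⟩
      f (n + π + σ) i              ≡⟨ steps i ⟩
      f (n + π) i +̄′ σ ·′ ρ        ≡⟨ cong (_+̄′ σ ·′ ρ) (periodic i n T≤n) ⟩
      f n i +̄′ π ·′ ρ +̄′ σ ·′ ρ    ≡⟨ +̄-swap (f n i) (π ·′ ρ) (σ ·′ ρ) ⟩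
      f n i +̄′ σ ·′ ρ +̄′ π ·′ ρ    ∎)
      where open ≡-Reasoning

    stepsAt-pullback* : ∀ {π σ T n} → PeriodicFrom R f π ρ T → T ≤ n →
                        ∀ k → StepsAt σ (n + k * π) → StepsAt σ n
    stepsAt-pullback* {n = n} periodic T≤n zero steps =
      subst (StepsAt _) (+-identityʳ n) steps
    stepsAt-pullback* {π} {n = n} periodic T≤n (suc k) steps =
      stepsAt-pullback periodic T≤n
        (stepsAt-pullback* periodic (≤-trans T≤n (m≤m+n n π)) k
          (subst (StepsAt _) (sym (+-assoc n π (k * π))) steps))

    periodicFrom-transfer : ∀ {π σ Tπ Tσ} → 1 ≤ π →
                            PeriodicFrom R f π ρ Tπ → PeriodicFrom R f σ ρ Tσ →
                            PeriodicFrom R f σ ρ Tπ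
    periodicFrom-transfer {π} {Tσ = Tσ} 1≤π periodicπ periodicσ i n Tπ≤n =
      stepsAt-pullback* periodicπ Tπ≤n Tσ (λ j → periodicσ j _ Tσ≤n+Tσπ) i
      where
      Tσ≤n+Tσπ : Tσ ≤ n + Tσ * π
      Tσ≤n+Tσπ = ≤-trans (m≤m*n Tσ π {{>-nonZero 1≤π}}) (m≤n+m (Tσ * π) n)

proposition3 : (R : CompleteOrderedField) (I : Set) → I →
    (f : ℕ → I → ℝ̄ R) (ρ : CompleteOrderedField.Carrier R) (π σ : ℕ) →
    1 ≤ π → 1 ≤ σ →
    EventuallyPeriodic R f π ρ → EventuallyPeriodic R f σ ρ →
    (Tπ Tσ : ℕ) → IsLeastThreshold R f π ρ Tπ → IsLeastThreshold R f σ ρ Tσ →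
    Tπ ≡ Tσ
proposition3 R I _ f ρ π σ 1≤π 1≤σ _ _ Tπ Tσ (periodicπ , leastπ) (periodicσ , leastσ) =
  ≤-antisym (leastπ Tσ (periodicFrom-transfer R f ρ 1≤σ periodicσ periodicπ))
            (leastσ Tπ (periodicFrom-transfer R f ρ 1≤π periodicπ periodicσ))
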